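{- Let $F$ be an hke collection with $\alpha=\alpha(F)$, let $A\in F$ and let $D$ be a finite set. Then $F\cup\{D\}$ is an hke collection if and only if $|D|=\alpha$ and for every pair $(\Gamma_1,\Gamma_2)$ of disjoint subcollections of $F-\{A\}$ with $\Gamma_1\cup\Gamma_2=F-\{A\}$ and $\Gamma_2\neq\emptyset$ (with $\Gamma_1$ possibly empty), the following holds: $$\Big|A\cap D\cap \bigcap \Gamma_1-\bigcup \Gamma_2\Big|=\Big|\bigcap \Gamma_2-\bigcup \Gamma_1-A-D\Big|,$$ where, when $\Gamma_1=\emptyset$, one takes $\bigcap\Gamma_1=\bigcup(F\cup\{D\})$ and $\bigcup\Gamma_1=\emptyset$.
   Context: A non-empty finite collection $F$ of finite sets is an \emph{hke collection} if there is a positive integer $\alpha$ such that $|\bigcup \Gamma|+|\bigcap \Gamma|=2\alpha$ for every non-empty subcollection $\Gamma\subseteq F$; this $\alpha$ is $\alpha(F)$. $X-Y$ denotes set difference, and expressions are read left to right, e.g. $X\cap Y-Z-W=((X\cap Y)-Z)-W$. -}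

module Defs where

open import Data.Nat using (ℕ; suc; _+_; _*_; _<_)
open import Data.Fin using (Fin; zero; suc)
open import Data.Fin.Subset using (Subset; ⋃; ⋂; ∣_∣; Nonempty; Empty)
open import Data.Fin.Subset.Properties using (_∈?_)
open import Data.List using (List; map; filter; allFin; null)
open import Data.Product using (Σ; _×_)
open import Data.Bool using (if_then_else_)
open import Relation.Binary.PropositionalEquality using (_≡_)

-- A finite collection of finite sets is represented by
-- an (injective, when it is meant to be a set of sets) indexing
-- F : Fin m → Subset n.  Subcollections are index subsets Γ : Subset m.
Family : ℕ → ℕ → Set
Family m n = Fin m → Subset n

members : ∀ {m n} → Family m n → Subset m → List (Subset n)
members {m} F Γ = map F (filter (_∈? Γ) (allFin m))

bigUnion : ∀ {m n} → Family m n → Subset m → Subset n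
bigUnion F Γ = ⋃ (members F Γ)

-- ⋂ Γ for non-empty Γ (for Γ = ∅ this would be the whole universe;
-- the hke condition only uses non-empty Γ)
bigInter : ∀ {m n} → Family m n → Subset m → Subset n
bigInter F Γ = ⋂ (members F Γ)

bigInterOr : ∀ {m n} → Subset n → Family m n → Subset m → Subset n
bigInterOr {m} dflt F Γ =
  if null (filter (_∈? Γ) (allFin m)) then dflt else bigInter F Γ

-- F is an hke collection with α(F) = α:
--   α positive, and |⋃Γ| + |⋂Γ| = 2α for every non-empty subcollection Γ.
-- (Defined on indexed families; it depends only on the set {F i}, since
-- repeated members do not change unions/intersections of subcollections.)
IsHKE : ∀ {m n} → Family m n → ℕ → Set
IsHKE {m} F α =
  (0 < α) × (∀ (Γ : Subset m) → Nonempty Γ →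
              ∣ bigUnion F Γ ∣ + ∣ bigInter F Γ ∣ ≡ 2 * α)

HKE : ∀ {m n} → Family m n → Set
HKE {m} F = (0 < m) × Σ ℕ (IsHKE F)

addSet : ∀ {m n} → Subset n → Family m n → Family (suc m) n
addSet D F zero    = D
addSet D F (suc i) = F i

module Submission where

-- Every point x of the universe has a type: the set of indices i with x ∈ F i.
-- Writing ND S and NN S for the numbers of points of type S inside and outside D,
-- |⋃Γ| and |⋂Γ| are sums of ND + NN over the regions S meeting Γ, resp. containing
-- Γ, so every hke equation becomes a linear identity between region counts.  Then:
--   * the rows of F ∪ {D} avoiding D are those of F, the row {D} says |D| = α, and,
--     given the rows of F, the row Γ ∪ {D} says that ND and NN ∘ ∁ have the same sum
--     over the subsets of ∁ Γ;
--   * by Möbius inversion on the Boolean lattice, all these rows hold iff D swaps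
--     every region S ≠ ⊤, i.e. ND S = NN (∁ S);
--   * the regions of an hke family are complement-symmetric (again by Möbius
--     inversion), which propagates the swap property from the regions containing a
--     fixed index a to all regions;
--   * for a partition (Γ₁, Γ₂) of the indices other than a, the two sides of the
--     theorem's equation count exactly ND (∁ Γ₂) and NN Γ₂.

open import Defs
open import Algebra.Properties.CommutativeSemigroup using (interchange)
open import Data.Bool using (Bool; true; false; _∧_; _∨_; not; if_then_else_)
open import Data.Bool.Properties using (∧-zeroʳ; ∧-identityʳ; not-involutive)
open import Data.Fin using (Fin; zero; suc)
open import Data.Fin.Subset using (Subset; _∩_; _∪_; _─_; _-_; ⊤; ⊥; ∁; ⋃; ⋂; ⁅_⁆; ∣_∣; _∉_; Nonempty)
open import Data.Fin.Subset.Properties using (_∈?_)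
open import Data.List as List using (filter; null)
open import Data.Nat using (ℕ; zero; suc; _+_; _*_; _<_; _≤_; z≤n; s≤s)
open import Data.Nat.Induction using (<-wellFounded)
open import Data.Nat.Properties
  using (+-identityʳ; +-comm; +-assoc; +-commutativeSemigroup; m≤n⇒m≤1+n; +-cancelˡ-≡; +-cancelʳ-≡; *-cancelˡ-≡)
open import Data.Nat.Tactic.RingSolver using (solve-∀)
open import Data.Product using (_×_; _,_; proj₁; proj₂)
open import Data.Vec using ([]; _∷_; lookup; tabulate)
open import Data.Vec.Properties
  using (lookup-zipWith; lookup-replicate; lookup∘tabulate; tabulate∘lookup; ∷-injectiveʳ; []=⇒lookup; lookup⇒[]=)
open import Function using (_∘_)
open import Function.Bundles using (_⇔_; mk⇔)
open import Function.Definitions using (Injective)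
open import Induction.WellFounded using (module All)
open import Relation.Binary.Construct.On as On using ()
open import Relation.Binary.PropositionalEquality
open import Relation.Nullary using (does)

⟦_⟧ : Bool → ℕ
⟦ true ⟧ = 1
⟦ false ⟧ = 0

when : Bool → ℕ → ℕ
when true v = v
when false v = 0

sumF : ∀ {n} → (Fin n → ℕ) → ℕ
sumF {zero} f = 0
sumF {suc n} f = f zero + sumF (λ i → f (suc i))

sumS : ∀ {m} → (Subset m → ℕ) → ℕ
sumS {zero} f = f []
sumS {suc m} f = sumS (λ S → f (false ∷ S)) + sumS (λ S → f (true ∷ S))

+-interchange : ∀ a b c d → (a + b) + (c + d) ≡ (a + c) + (b + d)
+-interchange = interchange +-commutativeSemigroup

sumF-cong : ∀ {n} {f g : Fin n → ℕ} → (∀ i → f i ≡ g i) → sumF f ≡ sumF g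
sumF-cong {zero} e = refl
sumF-cong {suc n} e = cong₂ _+_ (e zero) (sumF-cong (λ i → e (suc i)))

sumF-+ : ∀ {n} (f g : Fin n → ℕ) → sumF (λ i → f i + g i) ≡ sumF f + sumF g
sumF-+ {zero} f g = refl
sumF-+ {suc n} f g = trans (cong (f zero + g zero +_) (sumF-+ (λ i → f (suc i)) (λ i → g (suc i))))
                           (+-interchange (f zero) (g zero) _ _)

sumF-0 : ∀ n → sumF {n} (λ _ → 0) ≡ 0
sumF-0 zero = refl
sumF-0 (suc n) = sumF-0 n

sumF-when : ∀ {n} c (f : Fin n → ℕ) → sumF (λ i → when c (f i)) ≡ when c (sumF f)
sumF-when true f = refl
sumF-when {n} false f = sumF-0 n

sumS-cong : ∀ {m} {f g : Subset m → ℕ} → (∀ S → f S ≡ g S) → sumS f ≡ sumS g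
sumS-cong {zero} e = e []
sumS-cong {suc m} e = cong₂ _+_ (sumS-cong (λ S → e (false ∷ S))) (sumS-cong (λ S → e (true ∷ S)))

sumS-+ : ∀ {m} (f g : Subset m → ℕ) → sumS (λ S → f S + g S) ≡ sumS f + sumS g
sumS-+ {zero} f g = refl
sumS-+ {suc m} f g =
  trans (cong₂ _+_ (sumS-+ (λ S → f (false ∷ S)) (λ S → g (false ∷ S)))
                   (sumS-+ (λ S → f (true ∷ S)) (λ S → g (true ∷ S))))
        (+-interchange (sumS (λ S → f (false ∷ S))) _ _ _)

sumS-0 : ∀ m → sumS {m} (λ _ → 0) ≡ 0
sumS-0 zero = refl
sumS-0 (suc m) = cong₂ _+_ (sumS-0 m) (sumS-0 m)

sumS-∁ : ∀ {m} (f : Subset m → ℕ) → sumS (λ S → f (∁ S)) ≡ sumS f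
sumS-∁ {zero} f = refl
sumS-∁ {suc m} f = trans (cong₂ _+_ (sumS-∁ (λ S → f (true ∷ S))) (sumS-∁ (λ S → f (false ∷ S))))
                         (+-comm (sumS (λ S → f (true ∷ S))) _)

sumF-sumS-comm : ∀ {n m} (h : Fin n → Subset m → ℕ) →
  sumF (λ x → sumS (h x)) ≡ sumS (λ S → sumF (λ x → h x S))
sumF-sumS-comm {zero} {m} h = sym (sumS-0 m)
sumF-sumS-comm {suc n} h = trans (cong (sumS (h zero) +_) (sumF-sumS-comm (λ x → h (suc x))))
                                 (sym (sumS-+ (h zero) (λ S → sumF (λ x → h (suc x) S))))

when-+ : ∀ c a b → when c (a + b) ≡ when c a + when c b
when-+ true a b = refl
when-+ false a b = refl

when-split : ∀ c e v → when c v ≡ when (c ∧ e) v + when (c ∧ not e) v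
when-split true true v = sym (+-identityʳ v)
when-split true false v = refl
when-split false e v = refl

sumS-split : ∀ {m} (e : Subset m → Bool) (f : Subset m → ℕ) →
  sumS f ≡ sumS (λ S → when (e S) (f S)) + sumS (λ S → when (not (e S)) (f S))
sumS-split e f = trans (sumS-cong (λ S → when-split true (e S) (f S)))
                       (sumS-+ (λ S → when (e S) (f S)) (λ S → when (not (e S)) (f S)))

sumS-when-+ : ∀ {m} (c : Subset m → Bool) (f g : Subset m → ℕ) →
  sumS (λ S → when (c S) (f S + g S)) ≡ sumS (λ S → when (c S) (f S)) + sumS (λ S → when (c S) (g S))
sumS-when-+ c f g = trans (sumS-cong (λ S → when-+ (c S) (f S) (g S)))
                          (sumS-+ (λ S → when (c S) (f S)) (λ S → when (c S) (g S)))

sumS-when-cong : ∀ {m} (c : Subset m → Bool) {f g : Subset m → ℕ} →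
  (∀ S → c S ≡ true → f S ≡ g S) → sumS (λ S → when (c S) (f S)) ≡ sumS (λ S → when (c S) (g S))
sumS-when-cong c {f} {g} h = sumS-cong agree
  where
  agree : ∀ S → when (c S) (f S) ≡ when (c S) (g S)
  agree S with c S in eq
  ... | true = h S eq
  ... | false = refl

sumS-guard-cong : ∀ {m} {c d : Subset m → Bool} (f : Subset m → ℕ) →
  (∀ S → c S ≡ d S) → sumS (λ S → when (c S) (f S)) ≡ sumS (λ S → when (d S) (f S))
sumS-guard-cong f h = sumS-cong (λ S → cong (λ b → when b (f S)) (h S))

measure-induction : ∀ {m} (μ : Subset m → ℕ) (P : Subset m → Set) →
  (∀ U → (∀ {S} → μ S < μ U → P S) → P U) → ∀ U → P U
measure-induction μ P = All.wfRec (On.wellFounded μ <-wellFounded) _ P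

sameᵇ subᵇ meetsᵇ : ∀ {m} → Subset m → Subset m → Bool
sameᵇ [] [] = true
sameᵇ (a ∷ A) (b ∷ B) = (if a then b else not b) ∧ sameᵇ A B
subᵇ [] [] = true
subᵇ (a ∷ A) (b ∷ B) = (not a ∨ b) ∧ subᵇ A B
meetsᵇ [] [] = false
meetsᵇ (a ∷ A) (b ∷ B) = (a ∧ b) ∨ meetsᵇ A B

someᵇ fullᵇ : ∀ {m} → Subset m → Bool
someᵇ [] = false
someᵇ (a ∷ A) = a ∨ someᵇ A
fullᵇ [] = true
fullᵇ (a ∷ A) = a ∧ fullᵇ A

size : ∀ {m} → Subset m → ℕ
size [] = 0
size (a ∷ A) = ⟦ a ⟧ + size A

sameᵇ-sound : ∀ {m} (A B : Subset m) → sameᵇ A B ≡ true → A ≡ B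
sameᵇ-sound [] [] e = refl
sameᵇ-sound (true ∷ A) (true ∷ B) e = cong (true ∷_) (sameᵇ-sound A B e)
sameᵇ-sound (false ∷ A) (false ∷ B) e = cong (false ∷_) (sameᵇ-sound A B e)

sameᵇ-sym : ∀ {m} (A B : Subset m) → sameᵇ A B ≡ sameᵇ B A
sameᵇ-sym [] [] = refl
sameᵇ-sym (true ∷ A) (true ∷ B) = sameᵇ-sym A B
sameᵇ-sym (true ∷ A) (false ∷ B) = refl
sameᵇ-sym (false ∷ A) (true ∷ B) = refl
sameᵇ-sym (false ∷ A) (false ∷ B) = sameᵇ-sym A B

sameᵇ-⊥ : ∀ {m} (S : Subset m) → sameᵇ S ⊥ ≡ not (someᵇ S)
sameᵇ-⊥ [] = refl
sameᵇ-⊥ (true ∷ S) = refl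
sameᵇ-⊥ (false ∷ S) = sameᵇ-⊥ S

sameᵇ-⊤ : ∀ {m} (S : Subset m) → sameᵇ S ⊤ ≡ fullᵇ S
sameᵇ-⊤ [] = refl
sameᵇ-⊤ (true ∷ S) = sameᵇ-⊤ S
sameᵇ-⊤ (false ∷ S) = refl

none⇒⊥ : ∀ {m} (S : Subset m) → someᵇ S ≡ false → S ≡ ⊥
none⇒⊥ S e = sameᵇ-sound S ⊥ (trans (sameᵇ-⊥ S) (cong not e))

subᵇ-refl : ∀ {m} (A : Subset m) → subᵇ A A ≡ true
subᵇ-refl [] = refl
subᵇ-refl (true ∷ A) = subᵇ-refl A
subᵇ-refl (false ∷ A) = subᵇ-refl A

subᵇ-⊤ : ∀ {m} (S : Subset m) → subᵇ S ⊤ ≡ true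
subᵇ-⊤ [] = refl
subᵇ-⊤ (true ∷ S) = subᵇ-⊤ S
subᵇ-⊤ (false ∷ S) = subᵇ-⊤ S

subᵇ-⊥ : ∀ {m} (S : Subset m) → subᵇ ⊥ S ≡ true
subᵇ-⊥ [] = refl
subᵇ-⊥ (s ∷ S) = subᵇ-⊥ S

⊤-subᵇ : ∀ {m} (S : Subset m) → subᵇ ⊤ S ≡ sameᵇ S ⊤
⊤-subᵇ [] = refl
⊤-subᵇ (true ∷ S) = ⊤-subᵇ S
⊤-subᵇ (false ∷ S) = refl

meetsᵇ-⊤ : ∀ {m} (S : Subset m) → meetsᵇ ⊤ S ≡ someᵇ S
meetsᵇ-⊤ [] = refl
meetsᵇ-⊤ (true ∷ S) = refl
meetsᵇ-⊤ (false ∷ S) = meetsᵇ-⊤ S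

meetsᵇ-⊥ : ∀ {m} (S : Subset m) → meetsᵇ ⊥ S ≡ false
meetsᵇ-⊥ [] = refl
meetsᵇ-⊥ (s ∷ S) = meetsᵇ-⊥ S

¬meetsᵇ : ∀ {m} (G S : Subset m) → not (meetsᵇ G S) ≡ subᵇ S (∁ G)
¬meetsᵇ [] [] = refl
¬meetsᵇ (true ∷ G) (true ∷ S) = refl
¬meetsᵇ (true ∷ G) (false ∷ S) = ¬meetsᵇ G S
¬meetsᵇ (false ∷ G) (true ∷ S) = ¬meetsᵇ G S
¬meetsᵇ (false ∷ G) (false ∷ S) = ¬meetsᵇ G S

¬meetsᵇ-∁ : ∀ {m} (G S : Subset m) → not (meetsᵇ G (∁ S)) ≡ subᵇ G S
¬meetsᵇ-∁ [] [] = refl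
¬meetsᵇ-∁ (true ∷ G) (true ∷ S) = ¬meetsᵇ-∁ G S
¬meetsᵇ-∁ (true ∷ G) (false ∷ S) = refl
¬meetsᵇ-∁ (false ∷ G) (true ∷ S) = ¬meetsᵇ-∁ G S
¬meetsᵇ-∁ (false ∷ G) (false ∷ S) = ¬meetsᵇ-∁ G S

subᵇ-∁ : ∀ {m} (G S : Subset m) → subᵇ G (∁ S) ≡ subᵇ S (∁ G)
subᵇ-∁ [] [] = refl
subᵇ-∁ (true ∷ G) (true ∷ S) = refl
subᵇ-∁ (true ∷ G) (false ∷ S) = subᵇ-∁ G S
subᵇ-∁ (false ∷ G) (true ∷ S) = subᵇ-∁ G S
subᵇ-∁ (false ∷ G) (false ∷ S) = subᵇ-∁ G S

someᵇ-∁ : ∀ {m} (S : Subset m) → someᵇ (∁ S) ≡ not (fullᵇ S)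
someᵇ-∁ [] = refl
someᵇ-∁ (true ∷ S) = someᵇ-∁ S
someᵇ-∁ (false ∷ S) = refl

fullᵇ-∁ : ∀ {m} (S : Subset m) → fullᵇ (∁ S) ≡ not (someᵇ S)
fullᵇ-∁ [] = refl
fullᵇ-∁ (true ∷ S) = refl
fullᵇ-∁ (false ∷ S) = fullᵇ-∁ S

∁-involutive : ∀ {m} (S : Subset m) → ∁ (∁ S) ≡ S
∁-involutive [] = refl
∁-involutive (true ∷ S) = cong (true ∷_) (∁-involutive S)
∁-involutive (false ∷ S) = cong (false ∷_) (∁-involutive S)

∁-⊥ : ∀ {m} → ∁ (⊥ {m}) ≡ ⊤
∁-⊥ {zero} = refl
∁-⊥ {suc m} = cong (true ∷_) (∁-⊥ {m})

lookup-∁ : ∀ {m} (S : Subset m) i → lookup (∁ S) i ≡ not (lookup S i)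
lookup-∁ (x ∷ S) zero = refl
lookup-∁ (x ∷ S) (suc i) = lookup-∁ S i

subᵇ-full : ∀ {m} (S U : Subset m) → subᵇ S U ≡ true → fullᵇ S ≡ true → fullᵇ U ≡ true
subᵇ-full [] [] e f = refl
subᵇ-full (true ∷ S) (true ∷ U) e f = subᵇ-full S U e f

subᵇ-nonfull : ∀ {m} (S U : Subset m) → subᵇ S U ≡ true → fullᵇ U ≡ false → fullᵇ S ≡ false
subᵇ-nonfull S U su nu with fullᵇ S in e
... | false = refl
... | true = trans (sym (subᵇ-full S U su e)) nu

subᵇ-≤ : ∀ {m} (A B : Subset m) → subᵇ A B ≡ true → size A ≤ size B
subᵇ-≤ [] [] e = z≤n
subᵇ-≤ (true ∷ A) (true ∷ B) e = s≤s (subᵇ-≤ A B e)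
subᵇ-≤ (false ∷ A) (true ∷ B) e = m≤n⇒m≤1+n (subᵇ-≤ A B e)
subᵇ-≤ (false ∷ A) (false ∷ B) e = subᵇ-≤ A B e

subᵇ-< : ∀ {m} (A B : Subset m) → subᵇ A B ≡ true → sameᵇ A B ≡ false → size A < size B
subᵇ-< [] [] e ()
subᵇ-< (true ∷ A) (true ∷ B) e f = s≤s (subᵇ-< A B e f)
subᵇ-< (false ∷ A) (true ∷ B) e f = s≤s (subᵇ-≤ A B e)
subᵇ-< (false ∷ A) (false ∷ B) e f = subᵇ-< A B e f

∧-true : ∀ {a b} → a ∧ b ≡ true → (a ≡ true) × (b ≡ true)
∧-true {true} {true} e = refl , refl

not-true : ∀ {b} → not b ≡ true → b ≡ false
not-true {false} e = refl

sumS-point : ∀ {m} (U : Subset m) (f : Subset m → ℕ) → sumS (λ S → when (sameᵇ S U) (f S)) ≡ f U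
sumS-point [] f = refl
sumS-point {suc m} (false ∷ U) f =
  trans (cong₂ _+_ (sumS-point U (λ S → f (false ∷ S))) (sumS-0 m)) (+-identityʳ _)
sumS-point {suc m} (true ∷ U) f = cong₂ _+_ (sumS-0 m) (sumS-point U (λ S → f (true ∷ S)))

sumS-extract : ∀ {m} (c : Subset m → Bool) (U : Subset m) → c U ≡ true → (f : Subset m → ℕ) →
  sumS (λ S → when (c S) (f S)) ≡ f U + sumS (λ S → when (c S ∧ not (sameᵇ S U)) (f S))
sumS-extract c U cU f = begin
  sumS (λ S → when (c S) (f S))
    ≡⟨ sumS-cong (λ S → when-split (c S) (sameᵇ S U) (f S)) ⟩
  sumS (λ S → when (c S ∧ sameᵇ S U) (f S) + when (c S ∧ not (sameᵇ S U)) (f S))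
    ≡⟨ sumS-+ (λ S → when (c S ∧ sameᵇ S U) (f S)) _ ⟩
  sumS (λ S → when (c S ∧ sameᵇ S U) (f S)) + sumS (λ S → when (c S ∧ not (sameᵇ S U)) (f S))
    ≡⟨ cong (_+ sumS (λ S → when (c S ∧ not (sameᵇ S U)) (f S))) (trans (sumS-guard-cong f only-U) (sumS-point U f)) ⟩
  f U + sumS (λ S → when (c S ∧ not (sameᵇ S U)) (f S)) ∎
  where
  open ≡-Reasoning
  only-U : ∀ S → (c S ∧ sameᵇ S U) ≡ sameᵇ S U
  only-U S with sameᵇ S U in e
  ... | false = ∧-zeroʳ (c S)
  ... | true rewrite sameᵇ-sound S U e = trans (∧-identityʳ (c U)) cU

downSum upSum : ∀ {m} → (Subset m → ℕ) → Subset m → ℕ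
downSum f U = sumS (λ S → when (subᵇ S U) (f S))
upSum f Γ = sumS (λ S → when (subᵇ Γ S) (f S))

-- Induction on |U|: the down-set sum at U is the value at U plus the sum over the
-- proper subsets of U, which agree by induction.
downSum-inversion : ∀ {m} (p q : Subset m → ℕ) →
  (∀ U → fullᵇ U ≡ false → downSum p U ≡ downSum q U) →
  ∀ S → fullᵇ S ≡ false → p S ≡ q S
downSum-inversion {m} p q sums = measure-induction size (λ U → fullᵇ U ≡ false → p U ≡ q U) step
  where
  step : ∀ U → (∀ {S} → size S < size U → fullᵇ S ≡ false → p S ≡ q S) → fullᵇ U ≡ false → p U ≡ q U
  step U ih nu = +-cancelʳ-≡ (below p) (p U) (q U) (begin
      p U + below p   ≡⟨ sym (sumS-extract (λ S → subᵇ S U) U (subᵇ-refl U) p) ⟩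
      downSum p U     ≡⟨ sums U nu ⟩
      downSum q U     ≡⟨ sumS-extract (λ S → subᵇ S U) U (subᵇ-refl U) q ⟩
      q U + below q   ≡⟨ cong (q U +_) (sym below-agree) ⟩
      q U + below p   ∎)
    where
    open ≡-Reasoning
    proper : Subset m → Bool
    proper S = subᵇ S U ∧ not (sameᵇ S U)
    below : (Subset m → ℕ) → ℕ
    below f = sumS (λ S → when (proper S) (f S))
    below-agree : below p ≡ below q
    below-agree = sumS-when-cong proper (λ S pS →
      let (su , ne) = ∧-true pS
      in ih (subᵇ-< S U su (not-true ne)) (subᵇ-nonfull S U su nu))

-- If M S counts the points whose set of containing members is exactly S, then
-- |⋃Γ| = unionCount M Γ and |⋂Γ| = upSum M Γ.
unionCount : ∀ {m} → (Subset m → ℕ) → Subset m → ℕ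
unionCount f Γ = sumS (λ S → when (meetsᵇ Γ S) (f S))

HkeRegions : ∀ {m} → (Subset m → ℕ) → ℕ → Set
HkeRegions M c = ∀ Γ → someᵇ Γ ≡ true → unionCount M Γ + upSum M Γ ≡ c

belowTop : ∀ {m} → (Subset m → ℕ) → Subset m → ℕ
belowTop f S = when (not (fullᵇ S)) (f S)

belowTop-nonfull : ∀ {m} (f : Subset m → ℕ) {S} → fullᵇ S ≡ false → belowTop f S ≡ f S
belowTop-nonfull f nf rewrite nf = refl

when-∧ : ∀ a b v → when (a ∧ b) v ≡ when a (when b v)
when-∧ true b v = refl
when-∧ false b v = refl

-- The points outside ⋃Γ are those whose complementary region contains Γ.
sumS-union-split : ∀ {m} (f : Subset m → ℕ) Γ → sumS f ≡ unionCount f Γ + upSum (f ∘ ∁) Γ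
sumS-union-split f Γ = trans (sumS-split (meetsᵇ Γ) f) (cong (unionCount f Γ +_) outside)
  where
  outside : sumS (λ S → when (not (meetsᵇ Γ S)) (f S)) ≡ upSum (f ∘ ∁) Γ
  outside = trans (sym (sumS-∁ (λ S → when (not (meetsᵇ Γ S)) (f S))))
                  (sumS-guard-cong (f ∘ ∁) (¬meetsᵇ-∁ Γ))

upSum-⊤ : ∀ {m} (f : Subset m → ℕ) → upSum f ⊤ ≡ f ⊤
upSum-⊤ f = trans (sumS-guard-cong f ⊤-subᵇ) (sumS-point ⊤ f)

upSum-belowTop : ∀ {m} (f : Subset m → ℕ) Γ → upSum f Γ ≡ f ⊤ + upSum (belowTop f) Γ
upSum-belowTop f Γ = trans (sumS-extract (subᵇ Γ) ⊤ (subᵇ-⊤ Γ) f) (cong (f ⊤ +_) (sumS-cong drop-⊤))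
  where
  drop-⊤ : ∀ S → when (subᵇ Γ S ∧ not (sameᵇ S ⊤)) (f S) ≡ when (subᵇ Γ S) (belowTop f S)
  drop-⊤ S rewrite sameᵇ-⊤ S = when-∧ (subᵇ Γ S) (not (fullᵇ S)) (f S)

downSum-∁ : ∀ {m} (f : Subset m → ℕ) U → downSum (f ∘ ∁) U ≡ upSum f (∁ U)
downSum-∁ f U = trans (sumS-guard-cong (f ∘ ∁) flip) (sumS-∁ (λ S → when (subᵇ (∁ U) S) (f S)))
  where
  flip : ∀ S → subᵇ S U ≡ subᵇ (∁ U) (∁ S)
  flip S = trans (cong (subᵇ S) (sym (∁-involutive U))) (sym (subᵇ-∁ (∁ U) S))

-- Comparing the hke equations at Γ and at ⊤
-- shows that M and M ∘ ∁ have equal up-set sums (away from ⊤) at every non-empty Γ;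
-- Möbius inversion, applied through complementation, gives the claim.
module ComplementSymmetry {k} (M : Subset (suc k) → ℕ) (c : ℕ) (hke : HkeRegions M c) where

  hke-complement : ∀ Γ → someᵇ Γ ≡ true → c + upSum (M ∘ ∁) Γ ≡ sumS M + upSum M Γ
  hke-complement Γ ne = begin
    c + upSum (M ∘ ∁) Γ                             ≡⟨ cong (_+ upSum (M ∘ ∁) Γ) (sym (hke Γ ne)) ⟩
    unionCount M Γ + upSum M Γ + upSum (M ∘ ∁) Γ    ≡⟨ swap (unionCount M Γ) (upSum M Γ) _ ⟩
    unionCount M Γ + upSum (M ∘ ∁) Γ + upSum M Γ    ≡⟨ cong (_+ upSum M Γ) (sym (sumS-union-split M Γ)) ⟩
    sumS M + upSum M Γ                              ∎
    where
    open ≡-Reasoning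
    swap : ∀ x a b → x + a + b ≡ x + b + a
    swap = solve-∀

  upSums-agree : ∀ Γ → someᵇ Γ ≡ true → upSum (belowTop (M ∘ ∁)) Γ ≡ upSum (belowTop M) Γ
  upSums-agree Γ ne = +-cancelˡ-≡ (c + M (∁ ⊤)) _ _ (begin
    c + M (∁ ⊤) + upSum (belowTop (M ∘ ∁)) Γ     ≡⟨ +-assoc c _ _ ⟩
    c + (M (∁ ⊤) + upSum (belowTop (M ∘ ∁)) Γ)   ≡⟨ cong (c +_) (sym (upSum-belowTop (M ∘ ∁) Γ)) ⟩
    c + upSum (M ∘ ∁) Γ                          ≡⟨ hke-complement Γ ne ⟩
    sumS M + upSum M Γ                           ≡⟨ cong (sumS M +_) (upSum-belowTop M Γ) ⟩
    sumS M + (M ⊤ + upSum (belowTop M) Γ)        ≡⟨ sym (+-assoc (sumS M) _ _) ⟩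
    sumS M + M ⊤ + upSum (belowTop M) Γ          ≡⟨ cong (_+ upSum (belowTop M) Γ) (sym at-⊤) ⟩
    c + M (∁ ⊤) + upSum (belowTop M) Γ           ∎)
    where
    open ≡-Reasoning
    at-⊤ : c + M (∁ ⊤) ≡ sumS M + M ⊤
    at-⊤ = trans (cong (c +_) (sym (upSum-⊤ (M ∘ ∁))))
                 (trans (hke-complement ⊤ refl) (cong (sumS M +_) (upSum-⊤ M)))

  complement-symmetric : ∀ Γ → someᵇ Γ ≡ true → fullᵇ Γ ≡ false → M Γ ≡ M (∁ Γ)
  complement-symmetric Γ ne nf = begin
    M Γ                                 ≡⟨ sym (belowTop-nonfull M nf) ⟩
    belowTop M Γ                        ≡⟨ cong (belowTop M) (sym (∁-involutive Γ)) ⟩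
    belowTop M (∁ (∁ Γ))                ≡⟨ inverted (∁ Γ) (trans (fullᵇ-∁ Γ) (cong not ne)) ⟩
    belowTop (M ∘ ∁) (∁ (∁ Γ))          ≡⟨ cong (belowTop (M ∘ ∁)) (∁-involutive Γ) ⟩
    belowTop (M ∘ ∁) Γ                  ≡⟨ belowTop-nonfull (M ∘ ∁) nf ⟩
    M (∁ Γ)                             ∎
    where
    open ≡-Reasoning
    inverted : ∀ S → fullᵇ S ≡ false → belowTop M (∁ S) ≡ belowTop (M ∘ ∁) (∁ S)
    inverted = downSum-inversion (belowTop M ∘ ∁) (belowTop (M ∘ ∁) ∘ ∁) (λ U nu →
      trans (downSum-∁ (belowTop M) U)
            (trans (sym (upSums-agree (∁ U) (trans (someᵇ-∁ U) (cong not nu))))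
                   (sym (downSum-∁ (belowTop (M ∘ ∁)) U))))

-- The points outside ⋃Γ are those whose region lies in ∁ Γ.
sumS-miss-split : ∀ {m} (f : Subset m → ℕ) Γ → sumS f ≡ unionCount f Γ + downSum f (∁ Γ)
sumS-miss-split f Γ = trans (sumS-split (meetsᵇ Γ) f) (cong (unionCount f Γ +_) (sumS-guard-cong f (¬meetsᵇ Γ)))

middle : ∀ {m} → Subset m → Bool
middle S = someᵇ S ∧ not (fullᵇ S)

middle-∁ : ∀ {m} (S : Subset m) → middle (∁ S) ≡ middle S
middle-∁ S rewrite someᵇ-∁ S | fullᵇ-∁ S with someᵇ S | fullᵇ S
... | true | true = refl
... | true | false = refl
... | false | true = refl
... | false | false = refl

sumS-⊥-split : ∀ {k} (f : Subset (suc k) → ℕ) → sumS f ≡ f ⊥ + unionCount f ⊤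
sumS-⊥-split f = trans (sumS-extract (λ _ → true) ⊥ refl f) (cong (f ⊥ +_) (sumS-guard-cong f nonempty))
  where
  nonempty : ∀ S → not (sameᵇ S ⊥) ≡ meetsᵇ ⊤ S
  nonempty S = trans (cong not (sameᵇ-⊥ S)) (trans (not-involutive (someᵇ S)) (sym (meetsᵇ-⊤ S)))

unionCount-⊤ : ∀ {k} (f : Subset (suc k) → ℕ) → unionCount f ⊤ ≡ f ⊤ + sumS (λ S → when (middle S) (f S))
unionCount-⊤ f = trans (sumS-extract (meetsᵇ ⊤) ⊤ refl f) (cong (f ⊤ +_) (sumS-guard-cong f proper))
  where
  proper : ∀ S → (meetsᵇ ⊤ S ∧ not (sameᵇ S ⊤)) ≡ middle S
  proper S = cong₂ (λ x y → x ∧ not y) (meetsᵇ-⊤ S) (sameᵇ-⊤ S)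

-- A point of type S (the set of members of F
-- containing it) is counted by ND S if it lies in D and by NN S otherwise; F is
-- hke with constant α iff M = ND + NN satisfies HkeRegions M (2 * α).
module Extension {k} (ND NN : Subset (suc k) → ℕ) (α : ℕ) where

  M : Subset (suc k) → ℕ
  M S = ND S + NN S

  -- the hke equation for Γ ∪ {D}: its union is D together with the points of ⋃Γ
  -- outside D, its intersection the points of D whose type contains Γ
  RowWithD : Subset (suc k) → Set
  RowWithD Γ = sumS ND + unionCount NN Γ + upSum ND Γ ≡ 2 * α

  Swaps : Subset (suc k) → Set
  Swaps S = ND S ≡ NN (∁ S)

  -- RowWithD Γ and the hke equation of F at Γ share all terms but one
  shared : Subset (suc k) → ℕ
  shared Γ = unionCount ND Γ + unionCount NN Γ + upSum ND Γ

  rowWithD-split : ∀ Γ → sumS ND + unionCount NN Γ + upSum ND Γ ≡ shared Γ + downSum ND (∁ Γ)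
  rowWithD-split Γ = trans (cong (λ t → t + unionCount NN Γ + upSum ND Γ) (sumS-miss-split ND Γ))
                           (rearrange (unionCount ND Γ) _ _ _)
    where
    rearrange : ∀ a a' b i → a + a' + b + i ≡ a + b + i + a'
    rearrange = solve-∀

  hke-split : ∀ Γ → unionCount M Γ + upSum M Γ ≡ shared Γ + downSum (NN ∘ ∁) (∁ Γ)
  hke-split Γ = trans (cong₂ _+_ (sumS-when-+ (meetsᵇ Γ) ND NN) (sumS-when-+ (subᵇ Γ) ND NN))
                      (trans (rearrange (unionCount ND Γ) _ _ _) (cong (shared Γ +_) upSum-NN))
    where
    rearrange : ∀ a b i j → a + b + (i + j) ≡ a + b + i + j
    rearrange = solve-∀
    upSum-NN : upSum NN Γ ≡ downSum (NN ∘ ∁) (∁ Γ)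
    upSum-NN = sym (trans (downSum-∁ NN (∁ Γ)) (cong (upSum NN) (∁-involutive Γ)))

  module _ (hke : HkeRegions M (2 * α)) where

    row⇒downSums : ∀ Γ → someᵇ Γ ≡ true → RowWithD Γ → downSum ND (∁ Γ) ≡ downSum (NN ∘ ∁) (∁ Γ)
    row⇒downSums Γ ne row =
      +-cancelˡ-≡ (shared Γ) _ _ (trans (sym (rowWithD-split Γ)) (trans row (trans (sym (hke Γ ne)) (hke-split Γ))))

    downSums⇒row : ∀ Γ → someᵇ Γ ≡ true → downSum ND (∁ Γ) ≡ downSum (NN ∘ ∁) (∁ Γ) → RowWithD Γ
    downSums⇒row Γ ne sums =
      trans (rowWithD-split Γ) (trans (cong (shared Γ +_) sums) (trans (sym (hke-split Γ)) (hke Γ ne)))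

    rows⇒swaps : (∀ Γ → someᵇ Γ ≡ true → RowWithD Γ) → ∀ S → fullᵇ S ≡ false → Swaps S
    rows⇒swaps rows = downSum-inversion ND (NN ∘ ∁) (λ U nu →
      let ne = trans (someᵇ-∁ U) (cong not nu)
      in subst (λ V → downSum ND V ≡ downSum (NN ∘ ∁) V) (∁-involutive U) (row⇒downSums (∁ U) ne (rows (∁ U) ne)))

    swaps⇒rows : (∀ S → fullᵇ S ≡ false → Swaps S) → ∀ Γ → someᵇ Γ ≡ true → RowWithD Γ
    swaps⇒rows swaps Γ ne = downSums⇒row Γ ne (sumS-when-cong (λ S → subᵇ S (∁ Γ)) (λ S su →
      swaps S (subᵇ-nonfull S (∁ Γ) su (trans (fullᵇ-∁ Γ) (cong not ne)))))

    -- Given |D| = α and the hke property of F, it is enough to know that D swaps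
    -- the non-full regions containing one fixed index a: a non-empty region S ∌ a
    -- is handled by complement symmetry (M S = M (∁ S)) together with the swap at
    -- ∁ S ∋ a, and the empty region by the hke equation of F at Γ = ⊤.
    module FromIndex (|D| : sumS ND ≡ α) (a : Fin (suc k))
                     (swaps-a : ∀ S → lookup S a ≡ true → fullᵇ S ≡ false → Swaps S) where

      open ComplementSymmetry M (2 * α) hke using (complement-symmetric)

      swaps-nonempty : ∀ S → someᵇ S ≡ true → fullᵇ S ≡ false → Swaps S
      swaps-nonempty S ne nf with lookup S a in a∈S
      ... | true = swaps-a S a∈S nf
      ... | false = +-cancelʳ-≡ (NN S) (ND S) (NN (∁ S)) (begin
            ND S + NN S            ≡⟨ complement-symmetric S ne nf ⟩
            ND (∁ S) + NN (∁ S)    ≡⟨ cong (_+ NN (∁ S)) swap-∁ ⟩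
            NN S + NN (∁ S)        ≡⟨ +-comm (NN S) _ ⟩
            NN (∁ S) + NN S        ∎)
        where
        open ≡-Reasoning
        swap-∁ : ND (∁ S) ≡ NN S
        swap-∁ = trans (swaps-a (∁ S) (trans (lookup-∁ S a) (cong not a∈S)) (trans (fullᵇ-∁ S) (cong not ne)))
                       (cong NN (∁-involutive S))

      -- With X the number of points of D in the middle regions (equal, by the swaps
      -- there, to the number outside D), the hke equation of F at ⊤ reads
      -- 2 (ND ⊤ + X) + 2 NN ⊤ = 2α = 2 |D| = 2 (ND ⊥ + ND ⊤ + X).
      swaps-empty : Swaps ⊥
      swaps-empty = trans (sym (halve (ND ⊤) X (NN ⊤) (ND ⊥) both)) (cong NN (sym ∁-⊥))
        where
        open ≡-Reasoning
        X X' : ℕ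
        X = sumS (λ S → when (middle S) (ND S))
        X' = sumS (λ S → when (middle S) (NN S))
        swaps-middle : ∀ S → middle S ≡ true → Swaps S
        swaps-middle S mid = swaps-nonempty S (proj₁ (∧-true mid)) (not-true (proj₂ (∧-true mid)))
        X'≡X : X' ≡ X
        X'≡X = begin
          X'                                              ≡⟨ sym (sumS-∁ (λ S → when (middle S) (NN S))) ⟩
          sumS (λ S → when (middle (∁ S)) (NN (∁ S)))     ≡⟨ sumS-guard-cong (NN ∘ ∁) middle-∁ ⟩
          sumS (λ S → when (middle S) (NN (∁ S)))         ≡⟨ sumS-when-cong middle (λ S mid → sym (swaps-middle S mid)) ⟩
          X                                               ∎
        halve : ∀ d x n e → d + x + (n + x) + (d + n) ≡ 2 * (e + (d + x)) → n ≡ e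
        halve d x n e h = *-cancelˡ-≡ n e 2 (+-cancelˡ-≡ (2 * (d + x)) _ _
          (trans (lhs d x n) (trans h (rhs e d x))))
          where
          lhs : ∀ d x n → 2 * (d + x) + 2 * n ≡ d + x + (n + x) + (d + n)
          lhs = solve-∀
          rhs : ∀ e d x → 2 * (e + (d + x)) ≡ 2 * (d + x) + 2 * e
          rhs = solve-∀
        both : ND ⊤ + X + (NN ⊤ + X) + (ND ⊤ + NN ⊤) ≡ 2 * (ND ⊥ + (ND ⊤ + X))
        both = begin
          ND ⊤ + X + (NN ⊤ + X) + (ND ⊤ + NN ⊤)     ≡⟨ cong (λ t → ND ⊤ + X + (NN ⊤ + t) + M ⊤) (sym X'≡X) ⟩
          ND ⊤ + X + (NN ⊤ + X') + M ⊤              ≡⟨ cong₂ (λ u v → u + v + M ⊤) (sym (unionCount-⊤ ND)) (sym (unionCount-⊤ NN)) ⟩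
          unionCount ND ⊤ + unionCount NN ⊤ + M ⊤   ≡⟨ cong₂ _+_ (sym (sumS-when-+ (meetsᵇ ⊤) ND NN)) (sym (upSum-⊤ M)) ⟩
          unionCount M ⊤ + upSum M ⊤                ≡⟨ hke ⊤ refl ⟩
          2 * α                                     ≡⟨ cong (2 *_) (sym |D|) ⟩
          2 * sumS ND                               ≡⟨ cong (2 *_) (trans (sumS-⊥-split ND) (cong (ND ⊥ +_) (unionCount-⊤ ND))) ⟩
          2 * (ND ⊥ + (ND ⊤ + X))                   ∎

      swaps-all : ∀ S → fullᵇ S ≡ false → Swaps S
      swaps-all S nf with someᵇ S in ne
      ... | true = swaps-nonempty S ne nf
      ... | false rewrite none⇒⊥ S ne = swaps-empty

typeOf : ∀ {m n} → Family m n → Fin n → Subset m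
typeOf G x = tabulate (λ i → lookup (G i) x)

lookup-typeOf : ∀ {m n} (G : Family m n) x i → lookup (typeOf G x) i ≡ lookup (G i) x
lookup-typeOf G x i = lookup∘tabulate (λ j → lookup (G j) x) i

card : ∀ {n} (s : Subset n) → ∣ s ∣ ≡ sumF (λ x → ⟦ lookup s x ⟧)
card [] = refl
card (true ∷ s) = cong suc (card s)
card (false ∷ s) = card s

lookup-∪ : ∀ {n} (A B : Subset n) x → lookup (A ∪ B) x ≡ lookup A x ∨ lookup B x
lookup-∪ A B x = lookup-zipWith _∨_ x A B

lookup-∩ : ∀ {n} (A B : Subset n) x → lookup (A ∩ B) x ≡ lookup A x ∧ lookup B x
lookup-∩ A B x = lookup-zipWith _∧_ x A B

lookup-─ : ∀ {n} (A B : Subset n) x → lookup (A ─ B) x ≡ lookup A x ∧ not (lookup B x)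
lookup-─ (a ∷ A) (true ∷ B) zero = sym (∧-zeroʳ a)
lookup-─ (a ∷ A) (false ∷ B) zero = sym (∧-identityʳ a)
lookup-─ (a ∷ A) (b ∷ B) (suc x) = lookup-─ A B x

lookup-∈? : ∀ {m} (i : Fin m) (Γ : Subset m) → does (i ∈? Γ) ≡ lookup Γ i
lookup-∈? zero (true ∷ Γ) = refl
lookup-∈? zero (false ∷ Γ) = refl
lookup-∈? (suc i) (b ∷ Γ) = lookup-∈? i Γ

-- Membership in ⋃ and ⋂ of the members selected by Γ, and emptiness of the
-- selection; stated for an arbitrary enumeration g of indices so that the
-- induction goes through, then specialised to the enumeration of all indices.
module Selection {m n} (G : Family m n) (Γ : Subset m) where

  selected : ∀ {k} → (Fin k → Fin m) → List.List (Fin m)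
  selected g = filter (_∈? Γ) (List.tabulate g)

  lookup-⋃ : ∀ {k} (g : Fin k → Fin m) x →
    lookup (⋃ (List.map G (selected g))) x ≡ meetsᵇ (tabulate (lookup Γ ∘ g)) (tabulate (λ j → lookup (G (g j)) x))
  lookup-⋃ {zero} g x = lookup-replicate x false
  lookup-⋃ {suc k} g x rewrite sym (lookup-∈? (g zero) Γ) with does (g zero ∈? Γ)
  ... | true = trans (lookup-∪ (G (g zero)) _ x) (cong (lookup (G (g zero)) x ∨_) (lookup-⋃ (g ∘ suc) x))
  ... | false = lookup-⋃ (g ∘ suc) x

  lookup-⋂ : ∀ {k} (g : Fin k → Fin m) x →
    lookup (⋂ (List.map G (selected g))) x ≡ subᵇ (tabulate (lookup Γ ∘ g)) (tabulate (λ j → lookup (G (g j)) x))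
  lookup-⋂ {zero} g x = lookup-replicate x true
  lookup-⋂ {suc k} g x rewrite sym (lookup-∈? (g zero) Γ) with does (g zero ∈? Γ)
  ... | true = trans (lookup-∩ (G (g zero)) _ x) (cong (lookup (G (g zero)) x ∧_) (lookup-⋂ (g ∘ suc) x))
  ... | false = lookup-⋂ (g ∘ suc) x

  null-selected : ∀ {k} (g : Fin k → Fin m) → null (selected g) ≡ not (someᵇ (tabulate (lookup Γ ∘ g)))
  null-selected {zero} g = refl
  null-selected {suc k} g rewrite sym (lookup-∈? (g zero) Γ) with does (g zero ∈? Γ)
  ... | true = refl
  ... | false = null-selected (g ∘ suc)

lookup-bigUnion : ∀ {m n} (G : Family m n) Γ x → lookup (bigUnion G Γ) x ≡ meetsᵇ Γ (typeOf G x)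
lookup-bigUnion G Γ x = trans (Selection.lookup-⋃ G Γ (λ i → i) x) (cong (λ V → meetsᵇ V (typeOf G x)) (tabulate∘lookup Γ))

lookup-bigInter : ∀ {m n} (G : Family m n) Γ x → lookup (bigInter G Γ) x ≡ subᵇ Γ (typeOf G x)
lookup-bigInter G Γ x = trans (Selection.lookup-⋂ G Γ (λ i → i) x) (cong (λ V → subᵇ V (typeOf G x)) (tabulate∘lookup Γ))

lookup-bigInterOr : ∀ {m n} (dflt : Subset n) (G : Family m n) Γ x →
  lookup (bigInterOr dflt G Γ) x ≡ (if someᵇ Γ then subᵇ Γ (typeOf G x) else lookup dflt x)
lookup-bigInterOr {m} dflt G Γ x
  rewrite Selection.null-selected G Γ (λ i → i) | tabulate∘lookup Γ with someᵇ Γ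
... | true = lookup-bigInter G Γ x
... | false = refl

some⇒Nonempty : ∀ {m} (Γ : Subset m) → someᵇ Γ ≡ true → Nonempty Γ
some⇒Nonempty (true ∷ Γ) e = zero , lookup⇒[]= zero (true ∷ Γ) refl
some⇒Nonempty (false ∷ Γ) e with some⇒Nonempty Γ e
... | (i , i∈Γ) = suc i , lookup⇒[]= (suc i) (false ∷ Γ) ([]=⇒lookup i∈Γ)

Nonempty⇒some : ∀ {m} (Γ : Subset m) → Nonempty Γ → someᵇ Γ ≡ true
Nonempty⇒some Γ (i , i∈Γ) = go Γ i ([]=⇒lookup i∈Γ)
  where
  go : ∀ {m} (Γ : Subset m) i → lookup Γ i ≡ true → someᵇ Γ ≡ true
  go (true ∷ Γ) i e = refl
  go (false ∷ Γ) (suc i) e = go Γ i e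

lookup⇒∉ : ∀ {m} (Γ : Subset m) a → lookup Γ a ≡ false → a ∉ Γ
lookup⇒∉ Γ a e a∈Γ with trans (sym ([]=⇒lookup a∈Γ)) e
... | ()

-- Checked coordinatewise: each index lies in
-- exactly one of A, Γ₁, Γ₂.
partition-region₁ : ∀ {m} (A Γ₁ Γ₂ T : Subset m) → Γ₁ ∩ Γ₂ ≡ ⊥ → Γ₁ ∪ Γ₂ ≡ ⊤ ─ A →
  (subᵇ A T ∧ subᵇ Γ₁ T) ∧ not (meetsᵇ Γ₂ T) ≡ sameᵇ T (∁ Γ₂)
partition-region₁ [] [] [] [] _ _ = refl
partition-region₁ (true ∷ A) (false ∷ Γ₁) (false ∷ Γ₂) (true ∷ T) e∩ e∪ =
  partition-region₁ A Γ₁ Γ₂ T (∷-injectiveʳ e∩) (∷-injectiveʳ e∪)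
partition-region₁ (true ∷ A) (false ∷ Γ₁) (false ∷ Γ₂) (false ∷ T) _ _ = refl
partition-region₁ (false ∷ A) (true ∷ Γ₁) (false ∷ Γ₂) (true ∷ T) e∩ e∪ =
  partition-region₁ A Γ₁ Γ₂ T (∷-injectiveʳ e∩) (∷-injectiveʳ e∪)
partition-region₁ (false ∷ A) (true ∷ Γ₁) (false ∷ Γ₂) (false ∷ T) _ _
  rewrite ∧-zeroʳ (subᵇ A T) = refl
partition-region₁ (false ∷ A) (false ∷ Γ₁) (true ∷ Γ₂) (true ∷ T) _ _ = ∧-zeroʳ _
partition-region₁ (false ∷ A) (false ∷ Γ₁) (true ∷ Γ₂) (false ∷ T) e∩ e∪ =
  partition-region₁ A Γ₁ Γ₂ T (∷-injectiveʳ e∩) (∷-injectiveʳ e∪)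
partition-region₁ (true ∷ A) (true ∷ Γ₁) (_ ∷ Γ₂) _ _ ()
partition-region₁ (true ∷ A) (false ∷ Γ₁) (true ∷ Γ₂) _ _ ()
partition-region₁ (false ∷ A) (true ∷ Γ₁) (true ∷ Γ₂) _ () _
partition-region₁ (false ∷ A) (false ∷ Γ₁) (false ∷ Γ₂) _ _ ()

partition-region₂ : ∀ {m} (A Γ₁ Γ₂ T : Subset m) → Γ₁ ∩ Γ₂ ≡ ⊥ → Γ₁ ∪ Γ₂ ≡ ⊤ ─ A →
  (subᵇ Γ₂ T ∧ not (meetsᵇ Γ₁ T)) ∧ not (meetsᵇ A T) ≡ sameᵇ T Γ₂
partition-region₂ [] [] [] [] _ _ = refl
partition-region₂ (true ∷ A) (false ∷ Γ₁) (false ∷ Γ₂) (true ∷ T) _ _ = ∧-zeroʳ _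
partition-region₂ (true ∷ A) (false ∷ Γ₁) (false ∷ Γ₂) (false ∷ T) e∩ e∪ =
  partition-region₂ A Γ₁ Γ₂ T (∷-injectiveʳ e∩) (∷-injectiveʳ e∪)
partition-region₂ (false ∷ A) (true ∷ Γ₁) (false ∷ Γ₂) (true ∷ T) _ _
  rewrite ∧-zeroʳ (subᵇ Γ₂ T) = refl
partition-region₂ (false ∷ A) (true ∷ Γ₁) (false ∷ Γ₂) (false ∷ T) e∩ e∪ =
  partition-region₂ A Γ₁ Γ₂ T (∷-injectiveʳ e∩) (∷-injectiveʳ e∪)
partition-region₂ (false ∷ A) (false ∷ Γ₁) (true ∷ Γ₂) (true ∷ T) e∩ e∪ =
  partition-region₂ A Γ₁ Γ₂ T (∷-injectiveʳ e∩) (∷-injectiveʳ e∪)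
partition-region₂ (false ∷ A) (false ∷ Γ₁) (true ∷ Γ₂) (false ∷ T) _ _ = refl
partition-region₂ (true ∷ A) (true ∷ Γ₁) (_ ∷ Γ₂) _ _ ()
partition-region₂ (true ∷ A) (false ∷ Γ₁) (true ∷ Γ₂) _ _ ()
partition-region₂ (false ∷ A) (true ∷ Γ₁) (true ∷ Γ₂) _ () _
partition-region₂ (false ∷ A) (false ∷ Γ₁) (false ∷ Γ₂) _ _ ()

difference-∩-∁ : ∀ {m} (S A : Subset m) → (S ─ A) ∩ ∁ S ≡ ⊥
difference-∩-∁ [] [] = refl
difference-∩-∁ (true ∷ S) (true ∷ A) = cong (false ∷_) (difference-∩-∁ S A)
difference-∩-∁ (true ∷ S) (false ∷ A) = cong (false ∷_) (difference-∩-∁ S A)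
difference-∩-∁ (false ∷ S) (true ∷ A) = cong (false ∷_) (difference-∩-∁ S A)
difference-∩-∁ (false ∷ S) (false ∷ A) = cong (false ∷_) (difference-∩-∁ S A)

difference-∪-∁ : ∀ {m} (S A : Subset m) → subᵇ A S ≡ true → (S ─ A) ∪ ∁ S ≡ ⊤ ─ A
difference-∪-∁ [] [] _ = refl
difference-∪-∁ (true ∷ S) (true ∷ A) A⊆S = cong (false ∷_) (difference-∪-∁ S A A⊆S)
difference-∪-∁ (true ∷ S) (false ∷ A) A⊆S = cong (true ∷_) (difference-∪-∁ S A A⊆S)
difference-∪-∁ (false ∷ S) (false ∷ A) A⊆S = cong (true ∷_) (difference-∪-∁ S A A⊆S)

subᵇ-⁅⁆ : ∀ {m} (a : Fin m) T → subᵇ ⁅ a ⁆ T ≡ lookup T a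
subᵇ-⁅⁆ zero (t ∷ T) rewrite subᵇ-⊥ T = ∧-identityʳ t
subᵇ-⁅⁆ (suc a) (t ∷ T) = subᵇ-⁅⁆ a T

meetsᵇ-⁅⁆ : ∀ {m} (a : Fin m) T → meetsᵇ ⁅ a ⁆ T ≡ lookup T a
meetsᵇ-⁅⁆ zero (true ∷ T) = refl
meetsᵇ-⁅⁆ zero (false ∷ T) = meetsᵇ-⊥ T
meetsᵇ-⁅⁆ (suc a) (t ∷ T) = meetsᵇ-⁅⁆ a T

lookup-⁅⁆ : ∀ {m} (a : Fin m) → lookup ⁅ a ⁆ a ≡ true
lookup-⁅⁆ zero = refl
lookup-⁅⁆ (suc a) = lookup-⁅⁆ a

indicator-split : ∀ e b (φ : Bool → Bool) →
  when e ⟦ φ b ⟧ ≡ when (φ true) ⟦ e ∧ b ⟧ + when (φ false) ⟦ e ∧ not b ⟧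
indicator-split false b φ = sym (cong₂ _+_ (when-0 (φ true)) (when-0 (φ false)))
  where
  when-0 : ∀ c → when c 0 ≡ 0
  when-0 true = refl
  when-0 false = refl
indicator-split true true φ with φ true | φ false
... | true | true = refl
... | true | false = refl
... | false | true = refl
... | false | false = refl
indicator-split true false φ with φ true | φ false
... | true | true = refl
... | true | false = refl
... | false | true = refl
... | false | false = refl

module Regions {k n} (F : Family (suc k) n) (D : Subset n) (α : ℕ) where

  type : Fin n → Subset (suc k)
  type = typeOf F

  inD : Fin n → Bool
  inD x = lookup D x

  ND NN : Subset (suc k) → ℕ
  ND S = sumF (λ x → ⟦ sameᵇ (type x) S ∧ inD x ⟧)
  NN S = sumF (λ x → ⟦ sameᵇ (type x) S ∧ not (inD x) ⟧)

  open Extension ND NN α public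

  count-by-type : ∀ (φ : Subset (suc k) → Bool → Bool) →
    sumF (λ x → ⟦ φ (type x) (inD x) ⟧) ≡ sumS (λ S → when (φ S true) (ND S) + when (φ S false) (NN S))
  count-by-type φ = begin
    sumF (λ x → ⟦ φ (type x) (inD x) ⟧)
      ≡⟨ sumF-cong (λ x → sym (sumS-point (type x) (λ S → ⟦ φ S (inD x) ⟧))) ⟩
    sumF (λ x → sumS (λ S → when (sameᵇ S (type x)) ⟦ φ S (inD x) ⟧))
      ≡⟨ sumF-sumS-comm (λ x S → when (sameᵇ S (type x)) ⟦ φ S (inD x) ⟧) ⟩
    sumS (λ S → sumF (λ x → when (sameᵇ S (type x)) ⟦ φ S (inD x) ⟧))
      ≡⟨ sumS-cong per-region ⟩
    sumS (λ S → when (φ S true) (ND S) + when (φ S false) (NN S)) ∎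
    where
    open ≡-Reasoning
    per-region : ∀ S → sumF (λ x → when (sameᵇ S (type x)) ⟦ φ S (inD x) ⟧) ≡ when (φ S true) (ND S) + when (φ S false) (NN S)
    per-region S = begin
      sumF (λ x → when (sameᵇ S (type x)) ⟦ φ S (inD x) ⟧)
        ≡⟨ sumF-cong (λ x → trans (indicator-split (sameᵇ S (type x)) (inD x) (φ S))
             (cong (λ e → when (φ S true) ⟦ e ∧ inD x ⟧ + when (φ S false) ⟦ e ∧ not (inD x) ⟧) (sameᵇ-sym S (type x)))) ⟩
      sumF (λ x → when (φ S true) ⟦ sameᵇ (type x) S ∧ inD x ⟧ + when (φ S false) ⟦ sameᵇ (type x) S ∧ not (inD x) ⟧)
        ≡⟨ sumF-+ (λ x → when (φ S true) ⟦ sameᵇ (type x) S ∧ inD x ⟧) _ ⟩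
      sumF (λ x → when (φ S true) ⟦ sameᵇ (type x) S ∧ inD x ⟧) + sumF (λ x → when (φ S false) ⟦ sameᵇ (type x) S ∧ not (inD x) ⟧)
        ≡⟨ cong₂ _+_ (sumF-when (φ S true) (λ x → ⟦ sameᵇ (type x) S ∧ inD x ⟧))
                     (sumF-when (φ S false) (λ x → ⟦ sameᵇ (type x) S ∧ not (inD x) ⟧)) ⟩
      when (φ S true) (ND S) + when (φ S false) (NN S) ∎

  card-by-type : ∀ (s : Subset n) (φ : Subset (suc k) → Bool → Bool) → (∀ x → lookup s x ≡ φ (type x) (inD x)) →
    ∣ s ∣ ≡ sumS (λ S → when (φ S true) (ND S) + when (φ S false) (NN S))
  card-by-type s φ h = trans (card s) (trans (sumF-cong (λ x → cong ⟦_⟧ (h x))) (count-by-type φ))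

  card-by-type-only : ∀ (s : Subset n) (ψ : Subset (suc k) → Bool) → (∀ x → lookup s x ≡ ψ (type x)) →
    ∣ s ∣ ≡ sumS (λ S → when (ψ S) (M S))
  card-by-type-only s ψ h = trans (card-by-type s (λ S _ → ψ S) h) (sumS-cong (λ S → sym (when-+ (ψ S) (ND S) (NN S))))

  -- The hke equation of F at Γ, and of F ∪ {D} at Γ and at Γ ∪ {D}, in region form.
  -- The family addSet D F gives a point x the type inD x ∷ type x.
  row-F : ∀ Γ → ∣ bigUnion F Γ ∣ + ∣ bigInter F Γ ∣ ≡ unionCount M Γ + upSum M Γ
  row-F Γ = cong₂ _+_ (card-by-type-only (bigUnion F Γ) (meetsᵇ Γ) (lookup-bigUnion F Γ))
                      (card-by-type-only (bigInter F Γ) (subᵇ Γ) (lookup-bigInter F Γ))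

  row-without-D : ∀ Γ → ∣ bigUnion (addSet D F) (false ∷ Γ) ∣ + ∣ bigInter (addSet D F) (false ∷ Γ) ∣
                          ≡ unionCount M Γ + upSum M Γ
  row-without-D Γ = cong₂ _+_ (card-by-type-only (bigUnion (addSet D F) (false ∷ Γ)) (meetsᵇ Γ) (lookup-bigUnion (addSet D F) (false ∷ Γ)))
                              (card-by-type-only (bigInter (addSet D F) (false ∷ Γ)) (subᵇ Γ) (lookup-bigInter (addSet D F) (false ∷ Γ)))

  row-with-D : ∀ Γ → ∣ bigUnion (addSet D F) (true ∷ Γ) ∣ + ∣ bigInter (addSet D F) (true ∷ Γ) ∣
                       ≡ sumS ND + unionCount NN Γ + upSum ND Γ
  row-with-D Γ = cong₂ _+_
    (trans (card-by-type (bigUnion (addSet D F) (true ∷ Γ)) (λ S b → b ∨ meetsᵇ Γ S) (lookup-bigUnion (addSet D F) (true ∷ Γ)))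
           (sumS-+ ND (λ S → when (meetsᵇ Γ S) (NN S))))
    (trans (card-by-type (bigInter (addSet D F) (true ∷ Γ)) (λ S b → b ∧ subᵇ Γ S) (lookup-bigInter (addSet D F) (true ∷ Γ)))
           (sumS-cong (λ S → +-identityʳ (when (subᵇ Γ S) (ND S)))))

  card-D : ∣ D ∣ ≡ sumS ND
  card-D = trans (card-by-type D (λ S b → b) (λ x → refl)) (sumS-cong (λ S → +-identityʳ (ND S)))

  rowWithD-⊥ : sumS ND + unionCount NN ⊥ + upSum ND ⊥ ≡ 2 * sumS ND
  rowWithD-⊥ = trans (cong₂ (λ u i → sumS ND + u + i) no-union (sumS-guard-cong ND subᵇ-⊥)) (twice (sumS ND))
    where
    no-union : unionCount NN ⊥ ≡ 0
    no-union = trans (sumS-guard-cong NN meetsᵇ-⊥) (sumS-0 (suc k))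
    twice : ∀ d → d + 0 + d ≡ 2 * d
    twice = solve-∀

  hke-regions : IsHKE F α → HkeRegions M (2 * α)
  hke-regions hα Γ ne = trans (sym (row-F Γ)) (proj₂ hα Γ (some⇒Nonempty Γ ne))

  -- if F ∪ {D} is hke, its constant is α (compare the rows at Γ = F) ...
  extension-constant : IsHKE F α → ∀ {β} → IsHKE (addSet D F) β → β ≡ α
  extension-constant hα {β} hβ = *-cancelˡ-≡ β α 2
    (trans (sym (proj₂ hβ (false ∷ ⊤) (some⇒Nonempty (false ∷ ⊤) refl)))
           (trans (row-without-D ⊤) (hke-regions hα ⊤ refl)))

  extension-rows : IsHKE (addSet D F) α → ∀ Γ → RowWithD Γ
  extension-rows hα' Γ = trans (sym (row-with-D Γ)) (proj₂ hα' (true ∷ Γ) (some⇒Nonempty (true ∷ Γ) refl))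

  extension-card : IsHKE (addSet D F) α → ∣ D ∣ ≡ α
  extension-card hα' = trans card-D (*-cancelˡ-≡ (sumS ND) α 2 (trans (sym rowWithD-⊥) (extension-rows hα' ⊥)))

  extension-hke : IsHKE F α → ∣ D ∣ ≡ α → (∀ Γ → someᵇ Γ ≡ true → RowWithD Γ) → IsHKE (addSet D F) α
  extension-hke hα |D| rows = proj₁ hα , all-rows
    where
    all-rows : ∀ Γ → Nonempty Γ → ∣ bigUnion (addSet D F) Γ ∣ + ∣ bigInter (addSet D F) Γ ∣ ≡ 2 * α
    all-rows (false ∷ Γ) ne = trans (row-without-D Γ) (hke-regions hα Γ (Nonempty⇒some (false ∷ Γ) ne))
    all-rows (true ∷ Γ) _ with someᵇ Γ in ne
    ... | true = trans (row-with-D Γ) (rows Γ ne)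
    ... | false rewrite none⇒⊥ Γ ne = trans (row-with-D ⊥) (trans rowWithD-⊥ (cong (2 *_) (trans (sym card-D) |D|)))

  Condition : Fin (suc k) → Set
  Condition a = ∀ (Γ₁ Γ₂ : Subset (suc k)) →
    a ∉ Γ₁ → a ∉ Γ₂ → (Γ₁ ∩ Γ₂) ≡ ⊥ → (Γ₁ ∪ Γ₂) ≡ (⊤ - a) → Nonempty Γ₂ →
    ∣ (((F a ∩ D) ∩ bigInterOr (bigUnion (addSet D F) ⊤) F Γ₁) ─ bigUnion F Γ₂) ∣
      ≡ ∣ (((bigInter F Γ₂ ─ bigUnion F Γ₁) ─ F a) ─ D) ∣

  module Sides (a : Fin (suc k)) (Γ₁ Γ₂ : Subset (suc k)) (e∩ : Γ₁ ∩ Γ₂ ≡ ⊥) (e∪ : Γ₁ ∪ Γ₂ ≡ ⊤ - a) where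

    whole : Subset n
    whole = bigUnion (addSet D F) ⊤

    left right : Subset n
    left = ((F a ∩ D) ∩ bigInterOr whole F Γ₁) ─ bigUnion F Γ₂
    right = ((bigInter F Γ₂ ─ bigUnion F Γ₁) ─ F a) ─ D

    inter-on-D : ∀ x → inD x ≡ true → lookup (bigInterOr whole F Γ₁) x ≡ subᵇ Γ₁ (type x)
    inter-on-D x x∈D rewrite lookup-bigInterOr whole F Γ₁ x with someᵇ Γ₁ in ne
    ... | true = refl
    ... | false rewrite none⇒⊥ Γ₁ ne =
      trans (lookup-bigUnion (addSet D F) ⊤ x)
            (trans (cong (λ b → b ∨ meetsᵇ ⊤ (type x)) x∈D) (sym (subᵇ-⊥ (type x))))

    left-lookup : ∀ x → lookup left x ≡ sameᵇ (type x) (∁ Γ₂) ∧ inD x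
    left-lookup x
      rewrite lookup-─ ((F a ∩ D) ∩ bigInterOr whole F Γ₁) (bigUnion F Γ₂) x
            | lookup-∩ (F a ∩ D) (bigInterOr whole F Γ₁) x
            | lookup-∩ (F a) D x
            | sym (lookup-typeOf F x a)
            | lookup-bigUnion F Γ₂ x
            | sym (subᵇ-⁅⁆ a (type x))
      with inD x in x∈D
    ... | false rewrite ∧-zeroʳ (subᵇ ⁅ a ⁆ (type x)) | ∧-zeroʳ (sameᵇ (type x) (∁ Γ₂)) = refl
    ... | true rewrite ∧-identityʳ (subᵇ ⁅ a ⁆ (type x)) | ∧-identityʳ (sameᵇ (type x) (∁ Γ₂))
                     | inter-on-D x x∈D = partition-region₁ ⁅ a ⁆ Γ₁ Γ₂ (type x) e∩ e∪

    right-lookup : ∀ x → lookup right x ≡ sameᵇ (type x) Γ₂ ∧ not (inD x)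
    right-lookup x
      rewrite lookup-─ ((bigInter F Γ₂ ─ bigUnion F Γ₁) ─ F a) D x
            | lookup-─ (bigInter F Γ₂ ─ bigUnion F Γ₁) (F a) x
            | lookup-─ (bigInter F Γ₂) (bigUnion F Γ₁) x
            | lookup-bigInter F Γ₂ x
            | lookup-bigUnion F Γ₁ x
            | sym (lookup-typeOf F x a)
            | sym (meetsᵇ-⁅⁆ a (type x)) =
      cong (_∧ not (inD x)) (partition-region₂ ⁅ a ⁆ Γ₁ Γ₂ (type x) e∩ e∪)

    left-count : ∣ left ∣ ≡ ND (∁ Γ₂)
    left-count = trans (card left) (sumF-cong (λ x → cong ⟦_⟧ (left-lookup x)))

    right-count : ∣ right ∣ ≡ NN Γ₂
    right-count = trans (card right) (sumF-cong (λ x → cong ⟦_⟧ (right-lookup x)))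

  -- The condition at a says exactly that D swaps every non-full region containing a:
  -- the region ∁ Γ₂ contains a, and every such region S arises from the partition
  -- (S ─ {a}, ∁ S).
  swaps⇒condition : ∀ a → (∀ S → fullᵇ S ≡ false → Swaps S) → Condition a
  swaps⇒condition a swaps Γ₁ Γ₂ _ _ e∩ e∪ ne = begin
    ∣ left ∣          ≡⟨ left-count ⟩
    ND (∁ Γ₂)         ≡⟨ swaps (∁ Γ₂) (trans (fullᵇ-∁ Γ₂) (cong not (Nonempty⇒some Γ₂ ne))) ⟩
    NN (∁ (∁ Γ₂))     ≡⟨ cong NN (∁-involutive Γ₂) ⟩
    NN Γ₂             ≡⟨ sym right-count ⟩
    ∣ right ∣         ∎
    where
    open ≡-Reasoning
    open Sides a Γ₁ Γ₂ e∩ e∪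

  condition⇒swaps : ∀ a → Condition a → ∀ S → lookup S a ≡ true → fullᵇ S ≡ false → Swaps S
  condition⇒swaps a cond S a∈S nf = begin
    ND S              ≡⟨ cong ND (sym (∁-involutive S)) ⟩
    ND (∁ (∁ S))      ≡⟨ sym left-count ⟩
    ∣ left ∣          ≡⟨ cond (S ─ ⁅ a ⁆) (∁ S) a∉Γ₁ a∉∁S e∩ e∪ (some⇒Nonempty (∁ S) (trans (someᵇ-∁ S) (cong not nf))) ⟩
    ∣ right ∣         ≡⟨ right-count ⟩
    NN (∁ S)          ∎
    where
    open ≡-Reasoning
    e∩ : (S ─ ⁅ a ⁆) ∩ ∁ S ≡ ⊥
    e∩ = difference-∩-∁ S ⁅ a ⁆
    e∪ : (S ─ ⁅ a ⁆) ∪ ∁ S ≡ ⊤ - a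
    e∪ = difference-∪-∁ S ⁅ a ⁆ (trans (subᵇ-⁅⁆ a S) a∈S)
    open Sides a (S ─ ⁅ a ⁆) (∁ S) e∩ e∪
    a∉Γ₁ : a ∉ S ─ ⁅ a ⁆
    a∉Γ₁ = lookup⇒∉ (S ─ ⁅ a ⁆) a (trans (lookup-─ S ⁅ a ⁆ a) (trans (cong (λ b → lookup S a ∧ not b) (lookup-⁅⁆ a)) (∧-zeroʳ _)))
    a∉∁S : a ∉ ∁ S
    a∉∁S = lookup⇒∉ (∁ S) a (trans (lookup-∁ S a) (cong not a∈S))

-- The theorem.  An hke collection is non-empty, which rules out m = 0.
mainTheorem13 :
  ∀ {m n : ℕ} (F : Family m n) → Injective _≡_ _≡_ F →
  (α : ℕ) → HKE F → IsHKE F α →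
  (a : Fin m) (D : Subset n) →
  HKE (addSet D F)
    ⇔ ( (∣ D ∣ ≡ α)
      × (∀ (Γ₁ Γ₂ : Subset m) →
           a ∉ Γ₁ → a ∉ Γ₂ → (Γ₁ ∩ Γ₂) ≡ ⊥ → (Γ₁ ∪ Γ₂) ≡ (⊤ - a) →
           Nonempty Γ₂ →
           ∣ (((F a ∩ D) ∩ bigInterOr (bigUnion (addSet D F) ⊤) F Γ₁) ─ bigUnion F Γ₂) ∣
             ≡ ∣ (((bigInter F Γ₂ ─ bigUnion F Γ₁) ─ F a) ─ D) ∣))
mainTheorem13 {zero} F _ α (() , _) a D
mainTheorem13 {suc k} F _ α _ hα a D = mk⇔ necessary sufficient
  where
  open Regions F D α
  regions : HkeRegions M (2 * α)
  regions = hke-regions hα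
  necessary : HKE (addSet D F) → (∣ D ∣ ≡ α) × Condition a
  necessary (_ , β , hβ) = extension-card hα' , swaps⇒condition a (rows⇒swaps regions (λ Γ _ → extension-rows hα' Γ))
    where
    hα' : IsHKE (addSet D F) α
    hα' = subst (IsHKE (addSet D F)) (extension-constant hα hβ) hβ
  sufficient : (∣ D ∣ ≡ α) × Condition a → HKE (addSet D F)
  sufficient (|D| , cond) = s≤s z≤n , α , extension-hke hα |D| (swaps⇒rows regions swaps)
    where
    swaps : ∀ S → fullᵇ S ≡ false → Swaps S
    swaps = FromIndex.swaps-all regions (trans (sym card-D) |D|) a (condition⇒swaps a cond)
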